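{- Let $\bar{S}_n(2)$ denote the number of finite sequences $\mathbf{a}=(a_1,\ldots,a_m)$ (of any length $m\ge 1$) of positive integers that are bounded in average by $2$ and satisfy $K(\mathbf{a}) \leq n$. Then for every $\epsilon>0$ there is a constant $c_\epsilon>0$ such that $$\bar{S}_n(2) \geq c_\epsilon\, n^{2\log 2/\log(1+\sqrt{2})-\epsilon}$$ for all sufficiently large $n$.
   Context: A sequence $(a_1,\ldots,a_m)$ of positive integers is bounded in average by $B$ if $\sum_{i=1}^t a_i \leq Bt$ for every $t$ with $1\le t\le m$. The continuant $K(a_1,\ldots,a_m)$ is the denominator of the continued fraction $[0;a_1,\ldots,a_m]$; equivalently, $K(a_1,\ldots,a_m)=q_m$ where $q_{ -1}=0$, $q_0=1$ and $q_j=a_jq_{j-1}+q_{j-2}$ for $j\ge1$. -}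

module Defs where

open import Data.Nat using (ℕ; zero; suc; _+_; _*_; _∸_; _^_; _≤_; _<_)
open import Data.Nat.Properties using (_≤?_)
open import Data.Nat.ListAction using (sum)
open import Data.List using (List; []; _∷_; length; take; map; concatMap; applyUpTo; filter)
open import Data.List.Relation.Unary.All using (All; all?)
open import Data.Product using (_×_)
open import Relation.Nullary.Decidable using (Dec; _×-dec_)

-- Continuant K(a₁,…,a_m) = q_m, with q₋₁ = 0, q₀ = 1, q_j = a_j q_{j-1} + q_{j-2}.
-- 'contAux a qprev qcur' processes the remaining partial quotients a.
contAux : List ℕ → ℕ → ℕ → ℕ
contAux []       qprev qcur = qcur
contAux (a ∷ as) qprev qcur = contAux as qcur (a * qcur + qprev)

K : List ℕ → ℕ
K as = contAux as 0 1

Positive : List ℕ → Set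
Positive as = All (λ x → 1 ≤ x) as

BoundedInAverage : ℕ → List ℕ → Set
BoundedInAverage B as =
  All (λ t → sum (take t as) ≤ B * t) (applyUpTo suc (length as))

Counted : ℕ → List ℕ → Set
Counted n as = 1 ≤ length as × (Positive as × (BoundedInAverage 2 as × K as ≤ n))

counted? : (n : ℕ) → (as : List ℕ) → Dec (Counted n as)
counted? n as =
  (1 ≤? length as) ×-dec
  (all? (λ x → 1 ≤? x) as ×-dec
  (all? (λ t → sum (take t as) ≤? 2 * t) (applyUpTo suc (length as)) ×-dec
  (K as ≤? n)))

seqs : ℕ → ℕ → List (List ℕ)
seqs zero    M = [] ∷ []
seqs (suc m) M = concatMap (λ x → map (x ∷_) (seqs m M)) (applyUpTo suc M)

-- A finite candidate set containing every counted sequence: if K(a) ≤ n then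
-- the length m satisfies m ≤ F_{m+1} ≤ K(a) ≤ n, and bounded-in-average by 2
-- forces a_i ≤ 2i ≤ 2n.  Lists of distinct lengths are distinct, so no repetition.
candidates : ℕ → List (List ℕ)
candidates n = concatMap (λ m → seqs m (2 * n)) (applyUpTo suc n)

Sbar2 : ℕ → ℕ
Sbar2 n = length (filter (counted? n) (candidates n))

-- Coefficients of (1+√2)^p = A p + B p · √2.
sqA sqB : ℕ → ℕ
sqA zero    = 1
sqA (suc p) = sqA p + 2 * sqB p
sqB zero    = 0
sqB (suc p) = sqA p + sqB p

-- (1+√2)^p < 4^q, i.e. A + B√2 < 4^q, i.e. A < 4^q and 2B² < (4^q − A)².
-- For q > 0 this says exactly p/q < 2 log 2 / log(1+√2).
BelowExponent : ℕ → ℕ → Set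
BelowExponent p q =
  sqA p < 4 ^ q × 2 * (sqB p * sqB p) < (4 ^ q ∸ sqA p) * (4 ^ q ∸ sqA p)

{-# OPTIONS --safe #-}
module Submission where

-- Keep track of the slack s of a sequence bounded in average by 2 (so that a₁ + ⋯ + a_t ≤ 2t + s):
-- an induction along the sequence with the weights G t s shows that its continuant is at most the
-- Pell number P_{m+1} = K(2, …, 2).  Hence every such sequence of length m counts towards S̄_n(2) once
-- P_{m+1} ≤ n, and there are 2·C(2m+1, m)/(m+2) ≥ 4^m/((m+1)(m+2)) of them (ballot numbers).  For
-- P_{m+1} ≤ n < P_{m+2} this gives S̄_n(2)^q ≥ 4^{qm}/poly(m), while n^p ≤ P_{p(m+2)} grows only like
-- λ^m with λ = (1+√2)^p < 4^q, and the gap (4^q/λ)^m absorbs the polynomial loss.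

open import Defs
open import Data.Nat
open import Data.Nat.Properties
open import Data.Nat.Tactic.RingSolver using (solve-∀)
open import Data.Nat.ListAction using (sum)
open import Data.List using (List; []; _∷_; length; take; map; concatMap; _++_; applyUpTo; filter)
open import Data.List.Properties using (filter-++; length-++; filter-accept; filter-reject; map-applyUpTo)
open import Data.List.Membership.Propositional using (_∈_)
open import Data.List.Membership.Propositional.Properties using (∈-applyUpTo⁺)
open import Data.List.Relation.Unary.All as All using (All; []; _∷_)
open import Data.List.Relation.Unary.All.Properties using (applyUpTo⁺₂; concat⁺; map⁺; gmap⁺)
open import Data.List.Relation.Unary.Any using (here; there)
open import Data.Product using (Σ; _×_; _,_; proj₁; proj₂)
open import Data.Unit using (⊤; tt)
open import Data.Empty using (⊥-elim)
open import Relation.Binary.PropositionalEquality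
open import Relation.Nullary using (Dec; yes; no)
open import Relation.Nullary.Decidable using (_×-dec_)
open import Relation.Unary using (Pred; Decidable)
open import Algebra.Properties.CommutativeSemigroup +-commutativeSemigroup
  using () renaming (x∙yz≈y∙xz to x+[y+z]≡y+[x+z])
open import Algebra.Properties.CommutativeSemigroup *-commutativeSemigroup
  using ()
  renaming (x∙yz≈y∙xz to x*[y*z]≡y*[x*z]; xy∙z≈y∙xz to x*y*z≡y*[x*z]; interchange to *-interchange)
open import Function using (_∘_)
open import Level using (0ℓ)

weighted-sum-mono-≤ : ∀ {x y u v U W} → y ≤ x → u ≤ U → u + v ≤ U + W →
                      x * u + y * v ≤ x * U + y * W
weighted-sum-mono-≤ {x} {y} {u} {v} {U} {W} y≤x u≤U u+v≤U+W with m≤n⇒∃[o]m+o≡n y≤x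
... | d , refl = begin
  (y + d) * u + y * v   ≡⟨ regroup y d u v ⟩
  d * u + y * (u + v)   ≤⟨ +-mono-≤ (*-monoʳ-≤ d u≤U) (*-monoʳ-≤ y u+v≤U+W) ⟩
  d * U + y * (U + W)   ≡⟨ regroup y d U W ⟨
  (y + d) * U + y * W   ∎
  where
  open ≤-Reasoning
  regroup : ∀ y d u v → (y + d) * u + y * v ≡ d * u + y * (u + v)
  regroup = solve-∀

^-distrib-* : ∀ x y k → (x * y) ^ k ≡ x ^ k * y ^ k
^-distrib-* x y zero    = refl
^-distrib-* x y (suc k) = trans (cong (x * y *_) (^-distrib-* x y k)) (*-interchange x y (x ^ k) (y ^ k))

^-^-comm : ∀ a b c → (a ^ b) ^ c ≡ (a ^ c) ^ b
^-^-comm a b c = trans (^-*-assoc a b c) (trans (cong (a ^_) (*-comm b c)) (sym (^-*-assoc a c b)))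

suc-^-≤ : ∀ e k → suc k ^ suc e ≤ k ^ suc e + suc e * suc k ^ e
suc-^-≤ zero    k = ≤-reflexive (expand k)
  where
  expand : ∀ k → suc k * 1 ≡ k * 1 + 1 * 1
  expand = solve-∀
suc-^-≤ (suc e) k = begin
  suc k * suc k ^ suc e                                 ≤⟨ *-monoʳ-≤ (suc k) (suc-^-≤ e k) ⟩
  suc k * (k ^ suc e + suc e * suc k ^ e)               ≡⟨ expand k (k ^ suc e) e (suc k ^ e) ⟩
  k * k ^ suc e + k ^ suc e + suc e * (suc k * suc k ^ e)
    ≤⟨ +-monoˡ-≤ _ (+-monoʳ-≤ (k * k ^ suc e) (^-monoˡ-≤ (suc e) (n≤1+n k))) ⟩
  k * k ^ suc e + suc k ^ suc e + suc e * suc k ^ suc e ≡⟨ collect (k * k ^ suc e) (suc k ^ suc e) e ⟩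
  k * k ^ suc e + suc (suc e) * suc k ^ suc e           ∎
  where
  open ≤-Reasoning
  expand : ∀ k x e y → suc k * (x + suc e * y) ≡ k * x + x + suc e * (suc k * y)
  expand = solve-∀
  collect : ∀ x z e → x + z + suc e * z ≡ x + suc (suc e) * z
  collect = solve-∀

suc-^-ratio : ∀ U d k → suc U * d ≤ suc k → U * suc k ^ d ≤ suc U * k ^ d
suc-^-ratio U zero    k _ = *-monoˡ-≤ 1 (n≤1+n U)
suc-^-ratio U (suc e) k large = +-cancelʳ-≤ (suc k ^ suc e) _ _ (begin
  U * suc k ^ suc e + suc k ^ suc e                   ≡⟨ +-comm (U * suc k ^ suc e) _ ⟩
  suc U * suc k ^ suc e                               ≤⟨ *-monoʳ-≤ (suc U) (suc-^-≤ e k) ⟩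
  suc U * (k ^ suc e + suc e * suc k ^ e)             ≡⟨ distribute (suc U) (k ^ suc e) (suc e) (suc k ^ e) ⟩
  suc U * k ^ suc e + suc U * suc e * suc k ^ e       ≤⟨ +-monoʳ-≤ (suc U * k ^ suc e) (*-monoˡ-≤ (suc k ^ e) large) ⟩
  suc U * k ^ suc e + suc k ^ suc e                   ∎)
  where
  open ≤-Reasoning
  distribute : ∀ u x s y → u * (x + s * y) ≡ u * x + u * s * y
  distribute = solve-∀

-- Past k₀ = (U+1)d each step multiplies k^d by at most (U+1)/U (suc-^-ratio); C covers k ≤ k₀.
exp-dominates-poly : ∀ U d → Σ ℕ λ C → ∀ k → U ^ k * k ^ d ≤ C * suc U ^ k
exp-dominates-poly U d = C , bound
  where
  k₀ = suc U * d
  C = suc k₀ ^ d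
  bound : ∀ k → U ^ k * k ^ d ≤ C * suc U ^ k
  bound zero = begin
    1 * 0 ^ d              ≤⟨ *-monoʳ-≤ 1 (^-monoˡ-≤ d (z≤n {suc k₀})) ⟩
    1 * C                  ≡⟨ *-comm 1 C ⟩
    C * 1                  ∎
    where open ≤-Reasoning
  bound (suc k) with suc k ≤? k₀
  ... | yes small = begin
    U * U ^ k * suc k ^ d  ≤⟨ *-mono-≤ (^-monoˡ-≤ (suc k) (n≤1+n U)) (^-monoˡ-≤ d (m≤n⇒m≤1+n small)) ⟩
    suc U ^ suc k * C      ≡⟨ *-comm _ C ⟩
    C * suc U ^ suc k      ∎
    where open ≤-Reasoning
  ... | no large = begin
    U * U ^ k * suc k ^ d        ≡⟨ x*y*z≡y*[x*z] U (U ^ k) (suc k ^ d) ⟩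
    U ^ k * (U * suc k ^ d)      ≤⟨ *-monoʳ-≤ (U ^ k) (suc-^-ratio U d k (m≤n⇒m≤1+n (≮⇒≥ large))) ⟩
    U ^ k * (suc U * k ^ d)      ≡⟨ x*[y*z]≡y*[x*z] (U ^ k) (suc U) (k ^ d) ⟩
    suc U * (U ^ k * k ^ d)      ≤⟨ *-monoʳ-≤ (suc U) (bound k) ⟩
    suc U * (C * suc U ^ k)      ≡⟨ x*[y*z]≡y*[x*z] (suc U) C (suc U ^ k) ⟩
    C * (suc U * suc U ^ k)      ∎
    where open ≤-Reasoning

sum-applyUpTo-mono-≤ : ∀ {f g : ℕ → ℕ} {k n} → k ≤ n → (∀ i → i < k → f i ≤ g i) →
                       sum (applyUpTo f k) ≤ sum (applyUpTo g n)
sum-applyUpTo-mono-≤ {k = zero}              _           _    = z≤n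
sum-applyUpTo-mono-≤ {k = suc k} {suc n} (s≤s k≤n) f≤g =
  +-mono-≤ (f≤g 0 z<s) (sum-applyUpTo-mono-≤ k≤n (λ i i<k → f≤g (suc i) (s<s i<k)))

module _ {B : Set} {P : Pred B 0ℓ} (P? : Decidable P) where

  length-filter-++ : ∀ xs ys →
    length (filter P? (xs ++ ys)) ≡ length (filter P? xs) + length (filter P? ys)
  length-filter-++ xs ys = trans (cong length (filter-++ P? xs ys)) (length-++ (filter P? xs))

  length-filter-concatMap : ∀ {A : Set} (f : A → List B) xs →
    length (filter P? (concatMap f xs)) ≡ sum (map (λ x → length (filter P? (f x))) xs)
  length-filter-concatMap f []       = refl
  length-filter-concatMap f (x ∷ xs) =
    trans (length-filter-++ (f x) (concatMap f xs))
          (cong (length (filter P? (f x)) +_) (length-filter-concatMap f xs))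

  length-filter-concatMap-≥ : ∀ {A : Set} (f : A → List B) {x xs} → x ∈ xs →
    length (filter P? (f x)) ≤ length (filter P? (concatMap f xs))
  length-filter-concatMap-≥ f {xs = y ∷ ys} (here refl) =
    ≤-trans (m≤m+n _ _) (≤-reflexive (sym (length-filter-++ (f y) (concatMap f ys))))
  length-filter-concatMap-≥ f {xs = y ∷ ys} (there x∈ys) =
    ≤-trans (length-filter-concatMap-≥ f x∈ys)
            (≤-trans (m≤n+m _ _) (≤-reflexive (sym (length-filter-++ (f y) (concatMap f ys)))))

  length-filter-mono-≤ : ∀ {Q : Pred B 0ℓ} (Q? : Decidable Q) xs → All (λ x → P x → Q x) xs →
                         length (filter P? xs) ≤ length (filter Q? xs)
  length-filter-mono-≤ Q? []       []             = z≤n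
  length-filter-mono-≤ Q? (x ∷ xs) (P⇒Q ∷ P⇒Qs) with P? x | Q? x
  ... | yes _  | yes _  = s≤s (length-filter-mono-≤ Q? xs P⇒Qs)
  ... | yes Px | no ¬Qx = ⊥-elim (¬Qx (P⇒Q Px))
  ... | no _   | yes _  = m≤n⇒m≤1+n (length-filter-mono-≤ Q? xs P⇒Qs)
  ... | no _   | no _   = length-filter-mono-≤ Q? xs P⇒Qs

sqAB-+ : ∀ i j → sqA (i + j) ≡ sqA i * sqA j + 2 * (sqB i * sqB j)
             × sqB (i + j) ≡ sqA i * sqB j + sqB i * sqA j
sqAB-+ zero j = base₁ (sqA j) (sqB j) , base₂ (sqA j) (sqB j)
  where
  base₁ : ∀ a b → a ≡ 1 * a + 2 * (0 * b)
  base₁ = solve-∀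
  base₂ : ∀ a b → b ≡ 1 * b + 0 * a
  base₂ = solve-∀
sqAB-+ (suc i) j with sqAB-+ i j
... | eqA , eqB rewrite eqA | eqB =
  stepA (sqA i) (sqB i) (sqA j) (sqB j) , stepB (sqA i) (sqB i) (sqA j) (sqB j)
  where
  stepA : ∀ a b c d → (a * c + 2 * (b * d)) + 2 * (a * d + b * c)
                    ≡ (a + 2 * b) * c + 2 * ((a + b) * d)
  stepA = solve-∀
  stepB : ∀ a b c d → (a * c + 2 * (b * d)) + (a * d + b * c)
                    ≡ (a + 2 * b) * d + (a + b) * c
  stepB = solve-∀

sqA>0 : ∀ n → 0 < sqA n
sqA>0 zero    = ≤-refl
sqA>0 (suc n) = ≤-trans (sqA>0 n) (m≤m+n _ _)

sqB≤sqA : ∀ n → sqB n ≤ sqA n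
sqB≤sqA zero    = z≤n
sqB≤sqA (suc n) = +-monoʳ-≤ (sqA n) (m≤m+n (sqB n) (sqB n + 0))

sqB-<-suc : ∀ n → sqB (suc n) < sqB (2 + n)
sqB-<-suc n = m<n+m (sqB (suc n)) (sqA>0 (suc n))

n<sqB : ∀ n → n < sqB (suc n)
n<sqB zero    = ≤-refl
n<sqB (suc n) = ≤-trans (s≤s (n<sqB n)) (sqB-<-suc n)

sqB-superMultiplicative : ∀ i j → sqB i * sqB j ≤ sqB (i + j)
sqB-superMultiplicative i j = begin
  sqB i * sqB j                 ≤⟨ *-monoʳ-≤ (sqB i) (sqB≤sqA j) ⟩
  sqB i * sqA j                 ≤⟨ m≤n+m _ _ ⟩
  sqA i * sqB j + sqB i * sqA j ≡⟨ proj₂ (sqAB-+ i j) ⟨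
  sqB (i + j)                   ∎
  where open ≤-Reasoning

sqB-^ : ∀ p j → sqB j ^ suc p ≤ sqB (suc p * j)
sqB-^ zero    j = ≤-reflexive (trans (*-identityʳ (sqB j)) (cong sqB (sym (+-identityʳ j))))
sqB-^ (suc p) j = ≤-trans (*-monoʳ-≤ (sqB j) (sqB-^ p j)) (sqB-superMultiplicative j (suc p * j))

sqB-bracket : ∀ n → 2 ≤ n → Σ ℕ λ m → sqB (2 + m) ≤ n × n < sqB (3 + m)
sqB-bracket 1 (s≤s ())
sqB-bracket 2                   _ = 0 , ≤-refl , s≤s (s≤s (s≤s z≤n))
sqB-bracket (suc (suc (suc n))) _ with sqB-bracket (2 + n) (s≤s (s≤s z≤n))
... | m , lower , upper with 3 + n <? sqB (3 + m)
...   | yes below    = m , m≤n⇒m≤1+n lower , below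
...   | no  notBelow = suc m , ≤-reflexive hit , subst (_< sqB (4 + m)) hit (sqB-<-suc (2 + m))
  where
  hit : sqB (3 + m) ≡ 3 + n
  hit = ≤-antisym (≮⇒≥ notBelow) upper

-- G t s is the √2-coefficient of (1+√2)^t √2^s.
G : ℕ → ℕ → ℕ
G t zero          = sqB t
G t (suc zero)    = sqA t
G t (suc (suc s)) = 2 * G t s

G-rec : ∀ t s → G (2 + t) s ≡ 2 * G (suc t) s + G t s
G-rec t zero          = rec (sqA t) (sqB t)
  where
  rec : ∀ a b → (a + 2 * b) + (a + b) ≡ 2 * (a + b) + b
  rec = solve-∀
G-rec t (suc zero)    = rec (sqA t) (sqB t)
  where
  rec : ∀ a b → (a + 2 * b) + 2 * (a + b) ≡ 2 * (a + 2 * b) + a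
  rec = solve-∀
G-rec t (suc (suc s)) rewrite G-rec t s = rec (G (suc t) s) (G t s)
  where
  rec : ∀ a b → 2 * (2 * a + b) ≡ 2 * (2 * a) + 2 * b
  rec = solve-∀

G-suc : ∀ t s → G (suc t) (suc s) ≡ G (suc t) s + G t s
G-suc t zero          = rec (sqA t) (sqB t)
  where
  rec : ∀ a b → a + 2 * b ≡ (a + b) + b
  rec = solve-∀
G-suc t (suc zero)    = rec (sqA t) (sqB t)
  where
  rec : ∀ a b → 2 * (a + b) ≡ (a + 2 * b) + a
  rec = solve-∀
G-suc t (suc (suc s)) rewrite G-suc t s = *-distribˡ-+ 2 (G (suc t) s) (G t s)

G-one>0 : ∀ s → 0 < G 1 s
G-one>0 zero          = ≤-refl
G-one>0 (suc zero)    = ≤-refl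
G-one>0 (suc (suc s)) = ≤-trans (G-one>0 s) (m≤m+n (G 1 s) (G 1 s + 0))

G-monoʳ-≤ : ∀ t {s s'} → s ≤ s' → G (suc t) s ≤ G (suc t) s'
G-monoʳ-≤ t {s} {s'} s≤s' with m≤n⇒∃[o]m+o≡n s≤s'
... | d , refl = go d
  where
  go : ∀ d → G (suc t) s ≤ G (suc t) (s + d)
  go zero    = ≤-reflexive (cong (G (suc t)) (sym (+-identityʳ s)))
  go (suc d) = begin
    G (suc t) s                          ≤⟨ go d ⟩
    G (suc t) (s + d)                    ≤⟨ m≤m+n _ _ ⟩
    G (suc t) (s + d) + G t (s + d)      ≡⟨ G-suc t (s + d) ⟨
    G (suc t) (suc (s + d))              ≡⟨ cong (G (suc t)) (+-suc s d) ⟨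
    G (suc t) (s + suc d)                ∎
    where open ≤-Reasoning

G-step-2+ : ∀ t s' k → (2 + k) * G (suc t) s' + G t s' ≤ G (2 + t) (k + s')
G-step-2+ t s' zero    = ≤-reflexive (sym (G-rec t s'))
G-step-2+ t s' (suc k) = begin
  (3 + k) * g + h               ≡⟨ rearrange g h k ⟩
  ((2 + k) * g + h) + g         ≤⟨ +-mono-≤ (G-step-2+ t s' k) (G-monoʳ-≤ t (m≤n+m s' k)) ⟩
  G (2 + t) (k + s') + G (suc t) (k + s') ≡⟨ G-suc (suc t) (k + s') ⟨
  G (2 + t) (suc k + s')        ∎
  where
  open ≤-Reasoning
  g = G (suc t) s'
  h = G t s'
  rearrange : ∀ g h k → (3 + k) * g + h ≡ ((2 + k) * g + h) + g
  rearrange = solve-∀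

G-step : ∀ t s a → 1 ≤ a → a ≤ 2 + s →
  a * G (suc t) (2 + s ∸ a) + G t (2 + s ∸ a) ≤ G (2 + t) s ×
  a * G (suc t) (2 + s ∸ a) + G t (2 + s ∸ a) + G (suc t) (2 + s ∸ a) ≤ G (2 + t) s + G (suc t) s
G-step t s 1 _ _ = +-cancelʳ-≤ (G (suc t) s) _ _ first , ≤-reflexive second
  where
  open ≤-Reasoning
  g = G (suc t) (suc s)
  h = G t (suc s)
  second : 1 * g + h + g ≡ G (2 + t) s + G (suc t) s
  second = begin-equality
    1 * g + h + g   ≡⟨ rearrange g h ⟩
    2 * g + h       ≡⟨ G-rec t (suc s) ⟨
    G (2 + t) (suc s) ≡⟨ G-suc (suc t) s ⟩
    G (2 + t) s + G (suc t) s ∎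
    where
    rearrange : ∀ g h → 1 * g + h + g ≡ 2 * g + h
    rearrange = solve-∀
  first : 1 * g + h + G (suc t) s ≤ G (2 + t) s + G (suc t) s
  first = begin
    1 * g + h + G (suc t) s ≤⟨ +-monoʳ-≤ (1 * g + h) (G-monoʳ-≤ t (n≤1+n s)) ⟩
    1 * g + h + g           ≡⟨ second ⟩
    G (2 + t) s + G (suc t) s ∎
G-step t s (suc (suc k)) _ (s≤s (s≤s k≤s)) = go (s ∸ k) (m+[n∸m]≡n k≤s)
  where
  go : ∀ s' → k + s' ≡ s →
    (2 + k) * G (suc t) s' + G t s' ≤ G (2 + t) s ×
    (2 + k) * G (suc t) s' + G t s' + G (suc t) s' ≤ G (2 + t) s + G (suc t) s
  go s' refl = G-step-2+ t s' k
             , +-mono-≤ (G-step-2+ t s' k) (G-monoʳ-≤ t (m≤n+m s' k))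

-- a₁ + ⋯ + a_t ≤ 2t + s for every t, with all aᵢ ≥ 1; reading a turns slack s into 2 + s − a.
SlackBounded : ℕ → List ℕ → Set
SlackBounded s []       = ⊤
SlackBounded s (a ∷ as) = (1 ≤ a × a ≤ 2 + s) × SlackBounded (2 + s ∸ a) as

SlackBounded-sum-take : ∀ s as t → SlackBounded s as → sum (take t as) ≤ 2 * t + s
SlackBounded-sum-take s as       zero    _ = z≤n
SlackBounded-sum-take s []       (suc t) _ = z≤n
SlackBounded-sum-take s (a ∷ as) (suc t) ((_ , a≤2+s) , bounded) = begin
  a + sum (take t as)           ≤⟨ +-monoʳ-≤ a (SlackBounded-sum-take (2 + s ∸ a) as t bounded) ⟩
  a + (2 * t + (2 + s ∸ a))     ≡⟨ x+[y+z]≡y+[x+z] a (2 * t) (2 + s ∸ a) ⟩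
  2 * t + (a + (2 + s ∸ a))     ≡⟨ cong (2 * t +_) (m+[n∸m]≡n a≤2+s) ⟩
  2 * t + (2 + s)               ≡⟨ shift t s ⟩
  2 * suc t + s                 ∎
  where
  open ≤-Reasoning
  shift : ∀ t s → 2 * t + (2 + s) ≡ 2 * suc t + s
  shift = solve-∀

SlackBounded⇒Positive : ∀ s as → SlackBounded s as → Positive as
SlackBounded⇒Positive s []       _                   = []
SlackBounded⇒Positive s (a ∷ as) ((1≤a , _) , bounded) =
  1≤a ∷ SlackBounded⇒Positive (2 + s ∸ a) as bounded

SlackBounded⇒BoundedInAverage : ∀ as → SlackBounded 0 as → BoundedInAverage 2 as
SlackBounded⇒BoundedInAverage as bounded = applyUpTo⁺₂ suc (length as) λ t →
  subst (sum (take (suc t) as) ≤_) (+-identityʳ _) (SlackBounded-sum-take 0 as (suc t) bounded)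

contAux-bound : ∀ as s {x y} → y ≤ x → SlackBounded s as →
                contAux as y x ≤ G (suc (length as)) s * x + G (length as) s * y
contAux-bound []       s {x} {y} _ _ = begin
  x                       ≤⟨ m≤n*m x (G 1 s) {{>-nonZero (G-one>0 s)}} ⟩
  G 1 s * x               ≤⟨ m≤m+n _ _ ⟩
  G 1 s * x + G 0 s * y   ∎
  where open ≤-Reasoning
contAux-bound (a ∷ as) s {x} {y} y≤x ((1≤a , a≤2+s) , bounded) = begin
  contAux as x (a * x + y)                   ≤⟨ contAux-bound as s' x≤ax+y bounded ⟩
  G (suc r) s' * (a * x + y) + G r s' * x    ≡⟨ regroup (G (suc r) s') (G r s') a x y ⟩
  x * (a * G (suc r) s' + G r s') + y * G (suc r) s'
    ≤⟨ weighted-sum-mono-≤ y≤x (proj₁ step) (proj₂ step) ⟩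
  x * G (2 + r) s + y * G (suc r) s          ≡⟨ cong₂ _+_ (*-comm x _) (*-comm y _) ⟩
  G (2 + r) s * x + G (suc r) s * y          ∎
  where
  open ≤-Reasoning
  r = length as
  s' = 2 + s ∸ a
  step = G-step r s a 1≤a a≤2+s
  x≤ax+y : x ≤ a * x + y
  x≤ax+y = ≤-trans (m≤n*m x a {{>-nonZero 1≤a}}) (m≤m+n (a * x) y)
  regroup : ∀ g h a x y → g * (a * x + y) + h * x ≡ x * (a * g + h) + y * g
  regroup = solve-∀

K-bound : ∀ as → SlackBounded 0 as → K as ≤ sqB (suc (length as))
K-bound as bounded = begin
  K as                                                  ≤⟨ contAux-bound as 0 z≤n bounded ⟩
  sqB (suc (length as)) * 1 + sqB (length as) * 0
    ≡⟨ cong₂ _+_ (*-identityʳ _) (*-zeroʳ (sqB (length as))) ⟩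
  sqB (suc (length as)) + 0                             ≡⟨ +-identityʳ _ ⟩
  sqB (suc (length as))                                 ∎
  where open ≤-Reasoning

SlackBounded⇒Counted : ∀ {n} as → 0 < length as → sqB (suc (length as)) ≤ n →
                       SlackBounded 0 as → Counted n as
SlackBounded⇒Counted as nonempty short bounded =
  nonempty , SlackBounded⇒Positive 0 as bounded , SlackBounded⇒BoundedInAverage as bounded ,
  ≤-trans (K-bound as bounded) short

slackBounded? : ∀ s as → Dec (SlackBounded s as)
slackBounded? s []       = yes tt
slackBounded? s (a ∷ as) = ((1 ≤? a) ×-dec (a ≤? 2 + s)) ×-dec slackBounded? (2 + s ∸ a) as

slackCount : ℕ → ℕ → ℕ
slackCount zero    s = 1
slackCount (suc m) s = sum (applyUpTo (λ i → slackCount m (suc s ∸ i)) (2 + s))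

slackCount>0 : ∀ m s → 0 < slackCount m s
slackCount>0 zero    s = ≤-refl
slackCount>0 (suc m) s = ≤-trans (slackCount>0 m (suc s)) (m≤m+n _ _)

seqs-length : ∀ m M → All (λ as → length as ≡ m) (seqs m M)
seqs-length zero    M = refl ∷ []
seqs-length (suc m) M = concat⁺ (map⁺ (applyUpTo⁺₂ suc M λ _ → gmap⁺ (cong suc) (seqs-length m M)))

length-filter-slackBounded-∷ : ∀ s {a} → 1 ≤ a → a ≤ 2 + s → ∀ ass →
  length (filter (slackBounded? s) (map (a ∷_) ass)) ≡ length (filter (slackBounded? (2 + s ∸ a)) ass)
length-filter-slackBounded-∷ s         _   _      []         = refl
length-filter-slackBounded-∷ s {a} 1≤a a≤2+s (as ∷ ass) = byCase (slackBounded? (2 + s ∸ a) as)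
  where
  rest = length-filter-slackBounded-∷ s 1≤a a≤2+s ass
  byCase : Dec (SlackBounded (2 + s ∸ a) as) →
    length (filter (slackBounded? s) (map (a ∷_) (as ∷ ass)))
    ≡ length (filter (slackBounded? (2 + s ∸ a)) (as ∷ ass))
  byCase (yes bounded) = begin
    length (filter (slackBounded? s) ((a ∷ as) ∷ map (a ∷_) ass))
      ≡⟨ cong length (filter-accept (slackBounded? s) {a ∷ as} {map (a ∷_) ass} ((1≤a , a≤2+s) , bounded)) ⟩
    suc (length (filter (slackBounded? s) (map (a ∷_) ass)))      ≡⟨ cong suc rest ⟩
    suc (length (filter (slackBounded? (2 + s ∸ a)) ass))
      ≡⟨ cong length (filter-accept (slackBounded? (2 + s ∸ a)) {as} {ass} bounded) ⟨
    length (filter (slackBounded? (2 + s ∸ a)) (as ∷ ass))        ∎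
    where open ≡-Reasoning
  byCase (no unbounded) = begin
    length (filter (slackBounded? s) ((a ∷ as) ∷ map (a ∷_) ass))
      ≡⟨ cong length (filter-reject (slackBounded? s) {a ∷ as} {map (a ∷_) ass} (unbounded ∘ proj₂)) ⟩
    length (filter (slackBounded? s) (map (a ∷_) ass))            ≡⟨ rest ⟩
    length (filter (slackBounded? (2 + s ∸ a)) ass)
      ≡⟨ cong length (filter-reject (slackBounded? (2 + s ∸ a)) {as} {ass} unbounded) ⟨
    length (filter (slackBounded? (2 + s ∸ a)) (as ∷ ass))        ∎
    where open ≡-Reasoning

slackCount≤length-filter : ∀ m s M → suc (s + m) ≤ M →
                           slackCount m s ≤ length (filter (slackBounded? s) (seqs m M))
slackCount≤length-filter zero    s M _    = ≤-refl
slackCount≤length-filter (suc m) s M s+m<M = begin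
  sum (applyUpTo (λ i → slackCount m (suc s ∸ i)) (2 + s))    ≤⟨ sum-applyUpTo-mono-≤ 2+s≤M termwise ⟩
  sum (applyUpTo (count ∘ suc) M)                              ≡⟨ cong sum (map-applyUpTo suc count M) ⟨
  sum (map count (applyUpTo suc M))
    ≡⟨ length-filter-concatMap (slackBounded? s) _ (applyUpTo suc M) ⟨
  length (filter (slackBounded? s) (seqs (suc m) M))           ∎
  where
  open ≤-Reasoning
  count : ℕ → ℕ
  count a = length (filter (slackBounded? s) (map (a ∷_) (seqs m M)))
  2+s≤M : 2 + s ≤ M
  2+s≤M = ≤-trans (s≤s (s≤s (m≤m+n s m))) (subst (_≤ M) (cong suc (+-suc s m)) s+m<M)
  termwise : ∀ i → i < 2 + s → slackCount m (suc s ∸ i) ≤ count (suc i)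
  termwise i (s≤s i≤1+s) = begin
    slackCount m (suc s ∸ i)                                   ≤⟨ slackCount≤length-filter m (suc s ∸ i) M shorter ⟩
    length (filter (slackBounded? (suc s ∸ i)) (seqs m M))
      ≡⟨ length-filter-slackBounded-∷ s (s≤s z≤n) (s≤s i≤1+s) (seqs m M) ⟨
    count (suc i)                                              ∎
    where
    shorter : suc (suc s ∸ i + m) ≤ M
    shorter = ≤-trans (s≤s (+-monoˡ-≤ m (m∸n≤m (suc s) i))) (subst (_≤ M) (cong suc (+-suc s m)) s+m<M)

slackCount≤Sbar2 : ∀ {n} m → sqB (2 + m) ≤ n → slackCount (suc m) 0 ≤ Sbar2 n
slackCount≤Sbar2 {n} m short = begin
  slackCount (suc m) 0
    ≤⟨ slackCount≤length-filter (suc m) 0 (2 * n) length<2n ⟩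
  length (filter (slackBounded? 0) (seqs (suc m) (2 * n)))
    ≤⟨ length-filter-mono-≤ (slackBounded? 0) (counted? n) _ (All.map counted (seqs-length (suc m) (2 * n))) ⟩
  length (filter (counted? n) (seqs (suc m) (2 * n)))
    ≤⟨ length-filter-concatMap-≥ (counted? n) (λ m → seqs m (2 * n)) (∈-applyUpTo⁺ suc m<n) ⟩
  Sbar2 n                                                       ∎
  where
  open ≤-Reasoning
  1+m<n : suc m < n
  1+m<n = ≤-trans (n<sqB (suc m)) short
  m<n : m < n
  m<n = ≤-trans (n≤1+n (suc m)) 1+m<n
  length<2n : suc (0 + suc m) ≤ 2 * n
  length<2n = ≤-trans 1+m<n (m≤m+n n (n + 0))
  counted : ∀ {as} → length as ≡ suc m → SlackBounded 0 as → Counted n as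
  counted {as} length≡ = SlackBounded⇒Counted as (subst (0 <_) (sym length≡) (s≤s z≤n))
                                               (subst (λ l → sqB (suc l) ≤ n) (sym length≡) short)

-- paths a b = C(a + b, a), the number of lattice paths with a steps east and b steps north.
paths : ℕ → ℕ → ℕ
paths zero    b       = 1
paths (suc a) zero    = 1
paths (suc a) (suc b) = paths a (suc b) + paths (suc a) b

paths⁻ : ℕ → ℕ → ℕ
paths⁻ zero    b = 0
paths⁻ (suc a) b = paths a b

paths-pascal : ∀ a b → paths a (suc b) ≡ paths⁻ a (suc b) + paths a b
paths-pascal zero    b = refl
paths-pascal (suc a) b = refl

paths-comm : ∀ a b → paths a b ≡ paths b a
paths-comm zero    zero    = refl
paths-comm zero    (suc b) = refl
paths-comm (suc a) zero    = refl
paths-comm (suc a) (suc b) =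
  trans (cong₂ _+_ (paths-comm a (suc b)) (paths-comm (suc a) b)) (+-comm (paths (suc b) a) (paths b (suc a)))

paths-zeroʳ : ∀ a → paths a zero ≡ 1
paths-zeroʳ zero    = refl
paths-zeroʳ (suc a) = refl

slackCount-ballot : ∀ m s → slackCount m s + paths⁻ m (2 + (m + s)) ≡ paths m (suc (m + s))
slackCount-ballot zero    s = refl
slackCount-ballot (suc m) zero =
  subst (λ k → a₁ + (a₀ + 0) + paths m (3 + k) ≡ paths (suc m) (2 + k)) (sym (+-identityʳ m)) (begin
    a₁ + (a₀ + 0) + paths m (3 + m)    ≡⟨ cong (a₁ + (a₀ + 0) +_) (paths-pascal m (2 + m)) ⟩
    a₁ + (a₀ + 0) + (q₁ + Y)           ≡⟨ regroup a₁ a₀ q₁ Y ⟩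
    (a₁ + q₁) + (a₀ + Y)               ≡⟨ cong₂ (λ u v → u + (a₀ + v)) ballot₁ (paths-pascal m (suc m)) ⟩
    Y + (a₀ + (q₀ + X))                ≡⟨ cong (Y +_) (+-assoc a₀ q₀ X) ⟨
    Y + ((a₀ + q₀) + X)                ≡⟨ cong (λ u → Y + (u + X)) ballot₀ ⟩
    Y + (X + X)                        ≡⟨ cong (λ u → Y + (X + u)) (paths-comm m (suc m)) ⟩
    Y + (X + paths (suc m) m)          ∎)
  where
  open ≡-Reasoning
  a₀ = slackCount m 0
  a₁ = slackCount m 1
  q₀ = paths⁻ m (2 + m)
  q₁ = paths⁻ m (3 + m)
  X = paths m (suc m)
  Y = paths m (2 + m)
  ballot₀ : a₀ + q₀ ≡ X
  ballot₀ = subst (λ k → a₀ + paths⁻ m (2 + k) ≡ paths m (suc k)) (+-identityʳ m) (slackCount-ballot m 0)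
  ballot₁ : a₁ + q₁ ≡ Y
  ballot₁ = subst (λ k → a₁ + paths⁻ m (2 + k) ≡ paths m (suc k)) (+-comm m 1) (slackCount-ballot m 1)
  regroup : ∀ a₁ a₀ q₁ Y → a₁ + (a₀ + 0) + (q₁ + Y) ≡ (a₁ + q₁) + (a₀ + Y)
  regroup = solve-∀
slackCount-ballot (suc m) (suc s) =
  subst (λ k → a + c + paths m (3 + k) ≡ paths (suc m) (2 + k)) (sym (+-suc m s)) (begin
    a + c + paths m (4 + u)                   ≡⟨ cong (a + c +_) (paths-pascal m (3 + u)) ⟩
    a + c + (paths⁻ m (4 + u) + paths m (3 + u)) ≡⟨ regroup a c (paths⁻ m (4 + u)) (paths m (3 + u)) ⟩
    (a + paths⁻ m (4 + u)) + (c + paths m (3 + u)) ≡⟨ cong₂ _+_ ballot₂₊ₛ (slackCount-ballot (suc m) s) ⟩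
    paths m (3 + u) + paths (suc m) (2 + u)   ∎)
  where
  open ≡-Reasoning
  a = slackCount m (2 + s)
  c = slackCount (suc m) s
  u = m + s
  ballot₂₊ₛ : a + paths⁻ m (4 + u) ≡ paths m (3 + u)
  ballot₂₊ₛ = subst (λ k → a + paths⁻ m (2 + k) ≡ paths m (suc k))
                    (trans (+-suc m (suc s)) (cong suc (+-suc m s))) (slackCount-ballot m (2 + s))
  regroup : ∀ a c q y → a + c + (q + y) ≡ (a + q) + (c + y)
  regroup = solve-∀

paths-absorb′ : ∀ {n} a b → a + b ≡ n → suc a * paths (suc a) b ≡ suc (a + b) * paths a b
paths-absorb′ a zero _ rewrite paths-zeroʳ a | +-identityʳ a = refl
paths-absorb′ {zero}  a (suc b) a+b≡0 = ⊥-elim (m+1+n≢0 a a+b≡0)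
paths-absorb′ {suc n} a (suc b) a+b≡n = begin
  suc a * (P + paths (suc a) b)                  ≡⟨ *-distribˡ-+ (suc a) P _ ⟩
  suc a * P + suc a * paths (suc a) b            ≡⟨ cong (suc a * P +_) (paths-absorb′ a b a+b≡n-1) ⟩
  suc a * P + suc (a + b) * paths a b            ≡⟨ cong₂ (λ k l → suc a * P + suc k * l) (+-comm a b) (paths-comm a b) ⟩
  suc a * P + suc (b + a) * paths b a            ≡⟨ cong (suc a * P +_) (paths-absorb′ b a b+a≡n-1) ⟨
  suc a * P + suc b * paths (suc b) a            ≡⟨ cong (λ k → suc a * P + suc b * k) (paths-comm (suc b) a) ⟩
  suc a * P + suc b * P                          ≡⟨ collect a b P ⟩
  suc (a + suc b) * P                            ∎
  where
  open ≡-Reasoning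
  P = paths a (suc b)
  a+b≡n-1 : a + b ≡ n
  a+b≡n-1 = suc-injective (trans (sym (+-suc a b)) a+b≡n)
  b+a≡n-1 : b + a ≡ n
  b+a≡n-1 = trans (+-comm b a) a+b≡n-1
  collect : ∀ a b x → suc a * x + suc b * x ≡ suc (a + suc b) * x
  collect = solve-∀

paths-absorb : ∀ a b → suc a * paths (suc a) b ≡ suc (a + b) * paths a b
paths-absorb a b = paths-absorb′ a b refl

paths⁻-central : ∀ m → (2 + m) * paths⁻ m (2 + m) ≡ m * paths m (suc m)
paths⁻-central zero    = refl
paths⁻-central (suc a) = begin
  (3 + a) * paths a (3 + a)               ≡⟨ cong ((3 + a) *_) (paths-comm a (3 + a)) ⟩
  (3 + a) * paths (3 + a) a               ≡⟨ paths-absorb (2 + a) a ⟩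
  suc (2 + a + a) * paths (2 + a) a       ≡⟨ cong₂ _*_ (cong suc (+-comm (2 + a) a)) (paths-comm (2 + a) a) ⟩
  suc (a + (2 + a)) * paths a (2 + a)     ≡⟨ paths-absorb a (2 + a) ⟨
  suc a * paths (suc a) (2 + a)           ∎
  where open ≡-Reasoning

slackCount-zero : ∀ m → slackCount m 0 * (2 + m) ≡ 2 * paths m (suc m)
slackCount-zero m = +-cancelʳ-≡ (m * X) _ _ (begin
  slackCount m 0 * (2 + m) + m * X                      ≡⟨ cong (slackCount m 0 * (2 + m) +_) (paths⁻-central m) ⟨
  slackCount m 0 * (2 + m) + (2 + m) * paths⁻ m (2 + m)
    ≡⟨ cong (slackCount m 0 * (2 + m) +_) (*-comm (2 + m) (paths⁻ m (2 + m))) ⟩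
  slackCount m 0 * (2 + m) + paths⁻ m (2 + m) * (2 + m) ≡⟨ *-distribʳ-+ (2 + m) (slackCount m 0) _ ⟨
  (slackCount m 0 + paths⁻ m (2 + m)) * (2 + m)         ≡⟨ cong (_* (2 + m)) ballot ⟩
  X * (2 + m)                                           ≡⟨ expand X m ⟩
  2 * X + m * X                                         ∎)
  where
  open ≡-Reasoning
  X = paths m (suc m)
  ballot : slackCount m 0 + paths⁻ m (2 + m) ≡ X
  ballot = subst (λ k → slackCount m 0 + paths⁻ m (2 + k) ≡ paths m (suc k))
                 (+-identityʳ m) (slackCount-ballot m 0)
  expand : ∀ x m → x * (2 + m) ≡ 2 * x + m * x
  expand = solve-∀

paths-central-suc : ∀ m → (2 + m) * paths (suc m) (2 + m) ≡ 2 * (3 + 2 * m) * paths m (suc m)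
paths-central-suc m = *-cancelˡ-≡ _ _ (suc m) (begin
  suc m * ((2 + m) * paths (suc m) (2 + m))           ≡⟨ x*[y*z]≡y*[x*z] (suc m) (2 + m) (paths (suc m) (2 + m)) ⟩
  (2 + m) * (suc m * paths (suc m) (2 + m))           ≡⟨ cong ((2 + m) *_) (paths-absorb m (2 + m)) ⟩
  (2 + m) * (suc (m + (2 + m)) * paths m (2 + m))
    ≡⟨ cong (λ k → (2 + m) * (suc (m + (2 + m)) * k)) (paths-comm m (2 + m)) ⟩
  (2 + m) * (suc (m + (2 + m)) * paths (2 + m) m)     ≡⟨ x*[y*z]≡y*[x*z] (2 + m) (suc (m + (2 + m))) (paths (2 + m) m) ⟩
  suc (m + (2 + m)) * ((2 + m) * paths (2 + m) m)     ≡⟨ cong (suc (m + (2 + m)) *_) (paths-absorb (suc m) m) ⟩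
  suc (m + (2 + m)) * (suc (suc m + m) * paths (suc m) m)
    ≡⟨ cong (λ k → suc (m + (2 + m)) * (suc (suc m + m) * k)) (paths-comm (suc m) m) ⟩
  suc (m + (2 + m)) * (suc (suc m + m) * paths m (suc m)) ≡⟨ collect m (paths m (suc m)) ⟩
  suc m * (2 * (3 + 2 * m) * paths m (suc m))         ∎)
  where
  open ≡-Reasoning
  collect : ∀ m x → suc (m + (2 + m)) * (suc (suc m + m) * x) ≡ suc m * (2 * (3 + 2 * m) * x)
  collect = solve-∀

4^≤paths-central : ∀ m → 4 ^ m ≤ suc m * paths m (suc m)
4^≤paths-central zero    = ≤-refl
4^≤paths-central (suc m) = begin
  4 * 4 ^ m                              ≤⟨ *-monoʳ-≤ 4 (4^≤paths-central m) ⟩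
  4 * (suc m * paths m (suc m))          ≡⟨ *-assoc 4 (suc m) _ ⟨
  4 * suc m * paths m (suc m)            ≤⟨ *-monoˡ-≤ (paths m (suc m)) (4[1+m]≤2[3+2m] m) ⟩
  2 * (3 + 2 * m) * paths m (suc m)      ≡⟨ paths-central-suc m ⟨
  (2 + m) * paths (suc m) (2 + m)        ∎
  where
  open ≤-Reasoning
  4[1+m]≤2[3+2m] : ∀ m → 4 * suc m ≤ 2 * (3 + 2 * m)
  4[1+m]≤2[3+2m] m = subst (4 * suc m ≤_) (lemma m) (m≤m+n (4 * suc m) 2)
    where
    lemma : ∀ m → 4 * suc m + 2 ≡ 2 * (3 + 2 * m)
    lemma = solve-∀

4^≤slackCount : ∀ m → 4 ^ m ≤ slackCount m 0 * (suc m * (2 + m))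
4^≤slackCount m = begin
  4 ^ m                                 ≤⟨ 4^≤paths-central m ⟩
  suc m * paths m (suc m)               ≤⟨ *-monoʳ-≤ (suc m) (m≤n*m _ 2) ⟩
  suc m * (2 * paths m (suc m))         ≡⟨ cong (suc m *_) (slackCount-zero m) ⟨
  suc m * (slackCount m 0 * (2 + m))    ≡⟨ x*[y*z]≡y*[x*z] (suc m) (slackCount m 0) (2 + m) ⟩
  slackCount m 0 * (suc m * (2 + m))    ∎
  where open ≤-Reasoning

4^≤Sbar2 : ∀ {n} m → sqB (2 + m) ≤ n → 4 ^ suc m ≤ Sbar2 n * ((2 + m) * (3 + m))
4^≤Sbar2 m short = ≤-trans (4^≤slackCount (suc m)) (*-monoˡ-≤ _ (slackCount≤Sbar2 m short))

Sbar2>0 : ∀ {n} → 2 ≤ n → 0 < Sbar2 n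
Sbar2>0 2≤n = ≤-trans (slackCount>0 1 0) (slackCount≤Sbar2 0 2≤n)

-- With D = A + E (eventually D = 4^q), V k = c₁ A_{pk} + c₂ B_{pk} is a positive linear form that,
-- since 2B² < E² means E/B > √2, shrinks by T/2D = D − 1/2D < D under multiplication by (1+√2)^p.
-- c₂ = 2DE − 1 is passed together with its defining equation so that the ring solver applies.
module PellContraction (p E c₂ : ℕ) (c₂+1≡2DE : c₂ + 1 ≡ 2 * (sqA p + E) * E)
                       (2B²<E² : 2 * (sqB p * sqB p) < E * E) where

  A = sqA p
  B = sqB p
  D = A + E
  c₁ = 2 * D * B
  T = 2 * D * A + c₂

  V : ℕ → ℕ
  V k = c₁ * sqA (p * k) + c₂ * sqB (p * k)

  1+T≡2DD : suc T ≡ 2 * D * D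
  1+T≡2DD = begin
    suc T                       ≡⟨ +-comm 1 T ⟩
    2 * D * A + c₂ + 1          ≡⟨ +-assoc (2 * D * A) c₂ 1 ⟩
    2 * D * A + (c₂ + 1)        ≡⟨ cong (2 * D * A +_) c₂+1≡2DE ⟩
    2 * D * A + 2 * D * E       ≡⟨ *-distribˡ-+ (2 * D) A E ⟨
    2 * D * D                   ∎
    where open ≡-Reasoning

  first-coefficient : 2 * D * (c₁ * A + c₂ * B) ≡ T * c₁
  first-coefficient = identity A B E c₂
    where
    identity : ∀ A B E c₂ → 2 * (A + E) * (2 * (A + E) * B * A + c₂ * B)
                          ≡ (2 * (A + E) * A + c₂) * (2 * (A + E) * B)
    identity = solve-∀

  second-coefficient : 2 * D * (2 * B * c₁ + A * c₂) ≤ T * c₂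
  second-coefficient = +-cancelʳ-≤ (4 * D * D) _ _ (begin
    2 * D * (2 * B * c₁ + A * c₂) + 4 * D * D      ≡⟨ expand A B E c₂ ⟩
    2 * D * A * c₂ + 4 * D * D * suc (2 * (B * B)) ≤⟨ +-monoʳ-≤ (2 * D * A * c₂) (*-monoʳ-≤ (4 * D * D) 2B²<E²) ⟩
    2 * D * A * c₂ + 4 * D * D * (E * E)           ≡⟨ cong (2 * D * A * c₂ +_) (square D E) ⟩
    2 * D * A * c₂ + (2 * D * E) * (2 * D * E)     ≡⟨ cong (λ x → 2 * D * A * c₂ + x * x) c₂+1≡2DE ⟨
    2 * D * A * c₂ + (c₂ + 1) * (c₂ + 1)           ≡⟨ square-c₂ (2 * D * A) c₂ ⟩
    T * c₂ + (2 * c₂ + 1)                          ≤⟨ +-monoʳ-≤ (T * c₂) 2c₂+1≤4DD ⟩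
    T * c₂ + 4 * D * D                             ∎)
    where
    open ≤-Reasoning
    expand : ∀ A B E c₂ → 2 * (A + E) * (2 * B * (2 * (A + E) * B) + A * c₂) + 4 * (A + E) * (A + E)
                        ≡ 2 * (A + E) * A * c₂ + 4 * (A + E) * (A + E) * suc (2 * (B * B))
    expand = solve-∀
    square : ∀ D E → 4 * D * D * (E * E) ≡ (2 * D * E) * (2 * D * E)
    square = solve-∀
    square-c₂ : ∀ x c → x * c + (c + 1) * (c + 1) ≡ (x + c) * c + (2 * c + 1)
    square-c₂ = solve-∀
    2c₂+1≤4DD : 2 * c₂ + 1 ≤ 4 * D * D
    2c₂+1≤4DD = begin
      2 * c₂ + 1          ≤⟨ +-monoʳ-≤ (2 * c₂) (n≤1+n 1) ⟩
      2 * c₂ + 2          ≡⟨ *-distribˡ-+ 2 c₂ 1 ⟨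
      2 * (c₂ + 1)        ≡⟨ cong (2 *_) c₂+1≡2DE ⟩
      2 * (2 * D * E)     ≤⟨ *-monoʳ-≤ 2 (*-monoʳ-≤ (2 * D) (m≤n+m E A)) ⟩
      2 * (2 * D * D)     ≡⟨ reassoc D ⟩
      4 * D * D           ∎
      where
      reassoc : ∀ D → 2 * (2 * D * D) ≡ 4 * D * D
      reassoc = solve-∀

  V-step : ∀ k → 2 * D * V (suc k) ≤ T * V k
  V-step k = begin
    2 * D * V (suc k)
      ≡⟨ cong (λ j → 2 * D * (c₁ * sqA j + c₂ * sqB j)) (*-suc p k) ⟩
    2 * D * (c₁ * sqA (p + p * k) + c₂ * sqB (p + p * k))
      ≡⟨ cong₂ (λ x y → 2 * D * (c₁ * x + c₂ * y)) (proj₁ (sqAB-+ p (p * k))) (proj₂ (sqAB-+ p (p * k))) ⟩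
    2 * D * (c₁ * (A * a + 2 * (B * b)) + c₂ * (A * b + B * a))
      ≡⟨ regroup (2 * D) c₁ c₂ A B a b ⟩
    a * (2 * D * (c₁ * A + c₂ * B)) + b * (2 * D * (2 * B * c₁ + A * c₂))
      ≤⟨ +-mono-≤ (*-monoʳ-≤ a (≤-reflexive first-coefficient)) (*-monoʳ-≤ b second-coefficient) ⟩
    a * (T * c₁) + b * (T * c₂)
      ≡⟨ factor a b T c₁ c₂ ⟩
    T * V k ∎
    where
    open ≤-Reasoning
    a = sqA (p * k)
    b = sqB (p * k)
    regroup : ∀ x c₁ c₂ A B a b → x * (c₁ * (A * a + 2 * (B * b)) + c₂ * (A * b + B * a))
                                ≡ a * (x * (c₁ * A + c₂ * B)) + b * (x * (2 * B * c₁ + A * c₂))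
    regroup = solve-∀
    factor : ∀ a b T c₁ c₂ → a * (T * c₁) + b * (T * c₂) ≡ T * (c₁ * a + c₂ * b)
    factor = solve-∀

  V-geometric : ∀ k → (2 * D) ^ k * V k ≤ T ^ k * c₁
  V-geometric zero    rewrite *-zeroʳ p = ≤-reflexive (base c₁ c₂)
    where
    base : ∀ c₁ c₂ → 1 * (c₁ * 1 + c₂ * 0) ≡ 1 * c₁
    base = solve-∀
  V-geometric (suc k) = begin
    2 * D * (2 * D) ^ k * V (suc k)     ≡⟨ x*y*z≡y*[x*z] (2 * D) ((2 * D) ^ k) (V (suc k)) ⟩
    (2 * D) ^ k * (2 * D * V (suc k))   ≤⟨ *-monoʳ-≤ ((2 * D) ^ k) (V-step k) ⟩
    (2 * D) ^ k * (T * V k)             ≡⟨ x*[y*z]≡y*[x*z] ((2 * D) ^ k) T (V k) ⟩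
    T * ((2 * D) ^ k * V k)             ≤⟨ *-monoʳ-≤ T (V-geometric k) ⟩
    T * (T ^ k * c₁)                    ≡⟨ *-assoc T (T ^ k) c₁ ⟨
    T * T ^ k * c₁                      ∎
    where open ≤-Reasoning

sqB-mul-poly-≤ : ∀ p q d → BelowExponent p q →
                 Σ ℕ λ C → ∀ k → sqB (p * k) * k ^ d ≤ C * (4 ^ q) ^ k
sqB-mul-poly-≤ p q d (A<4^q , 2B²<E²) =
  c₁ * C′ , λ k → subst (λ x → sqB (p * k) * k ^ d ≤ c₁ * C′ * x ^ k) D≡4^q (bound k)
  where
  E = 4 ^ q ∸ sqA p
  D≡4^q : sqA p + E ≡ 4 ^ q
  D≡4^q = m+[n∸m]≡n (<⇒≤ A<4^q)
  0<E : 0 < E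
  0<E = m<n⇒0<n∸m A<4^q
  0<D : 0 < sqA p + E
  0<D = ≤-trans 0<E (m≤n+m E (sqA p))
  2≤2DE : 2 ≤ 2 * (sqA p + E) * E
  2≤2DE = *-mono-≤ (*-monoʳ-≤ 2 0<D) 0<E
  c₂ = 2 * (sqA p + E) * E ∸ 1
  c₂+1≡2DE : c₂ + 1 ≡ 2 * (sqA p + E) * E
  c₂+1≡2DE = m∸n+n≡m (≤-trans (s≤s z≤n) 2≤2DE)
  0<c₂ : 0 < c₂
  0<c₂ = +-cancelʳ-≤ 1 1 c₂ (subst (2 ≤_) (sym c₂+1≡2DE) 2≤2DE)
  open PellContraction p E c₂ c₂+1≡2DE 2B²<E²
  C′ = proj₁ (exp-dominates-poly T d)
  0<2D : 0 < 2 * D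
  0<2D = ≤-trans (s≤s z≤n) (*-monoʳ-≤ 2 0<D)
  bound : ∀ k → sqB (p * k) * k ^ d ≤ c₁ * C′ * D ^ k
  bound k = *-cancelˡ-≤ ((2 * D) ^ k) {{m^n≢0 (2 * D) k {{>-nonZero 0<2D}}}} (begin
    (2 * D) ^ k * (sqB (p * k) * k ^ d)   ≤⟨ *-monoʳ-≤ ((2 * D) ^ k) (*-monoˡ-≤ (k ^ d) sqB≤V) ⟩
    (2 * D) ^ k * (V k * k ^ d)           ≡⟨ *-assoc ((2 * D) ^ k) (V k) (k ^ d) ⟨
    (2 * D) ^ k * V k * k ^ d             ≤⟨ *-monoˡ-≤ (k ^ d) (V-geometric k) ⟩
    T ^ k * c₁ * k ^ d                    ≡⟨ x*y*z≡y*[x*z] (T ^ k) c₁ (k ^ d) ⟩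
    c₁ * (T ^ k * k ^ d)                  ≤⟨ *-monoʳ-≤ c₁ (proj₂ (exp-dominates-poly T d) k) ⟩
    c₁ * (C′ * suc T ^ k)                 ≡⟨ cong (λ x → c₁ * (C′ * x ^ k)) 1+T≡2DD ⟩
    c₁ * (C′ * (2 * D * D) ^ k)           ≡⟨ cong (λ x → c₁ * (C′ * x)) (^-distrib-* (2 * D) D k) ⟩
    c₁ * (C′ * ((2 * D) ^ k * D ^ k))     ≡⟨ shuffle c₁ C′ ((2 * D) ^ k) (D ^ k) ⟩
    (2 * D) ^ k * (c₁ * C′ * D ^ k)       ∎)
    where
    open ≤-Reasoning
    sqB≤V : sqB (p * k) ≤ V k
    sqB≤V = ≤-trans (m≤n*m (sqB (p * k)) c₂ {{>-nonZero 0<c₂}}) (m≤n+m _ _)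
    shuffle : ∀ a b c d → a * (b * (c * d)) ≡ c * (a * b * d)
    shuffle = solve-∀

pow-mul-poly-≤ : ∀ p d {C X n} m → (∀ k → sqB (suc p * k) * k ^ d ≤ C * X ^ k) → n < sqB (3 + m) →
                n ^ suc p * (3 + m) ^ d ≤ C * X ^ (3 + m)
pow-mul-poly-≤ p d {C} {X} {n} m sqB-bound below = begin
  n ^ suc p * (3 + m) ^ d              ≤⟨ *-monoˡ-≤ _ (^-monoˡ-≤ (suc p) (<⇒≤ below)) ⟩
  sqB (3 + m) ^ suc p * (3 + m) ^ d    ≤⟨ *-monoˡ-≤ _ (sqB-^ p (3 + m)) ⟩
  sqB (suc p * (3 + m)) * (3 + m) ^ d  ≤⟨ sqB-bound (3 + m) ⟩
  C * X ^ (3 + m)                      ∎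
  where open ≤-Reasoning

theorem1 : (p q : ℕ) → 0 < q → BelowExponent p q →
    Σ ℕ λ C → 1 ≤ C × Σ ℕ λ N → (n : ℕ) → N ≤ n → n ^ p ≤ C * Sbar2 n ^ q
theorem1 zero    q _ _ = 1 , ≤-refl , 2 , λ n 2≤n →
  ≤-trans (m^n>0 (Sbar2 n) {{>-nonZero (Sbar2>0 2≤n)}} q) (≤-reflexive (sym (*-identityˡ _)))
theorem1 (suc p) q _ below = suc C * (D * D) , 1≤C′ , 2 , bound
  where
  D = 4 ^ q
  C = proj₁ (sqB-mul-poly-≤ (suc p) q (q + q) below)
  sqB-bound = proj₂ (sqB-mul-poly-≤ (suc p) q (q + q) below)
  1≤C′ : 1 ≤ suc C * (D * D)
  1≤C′ = *-mono-≤ {1} {suc C} (s≤s z≤n) (*-mono-≤ {1} {D} (m^n>0 4 q) (m^n>0 4 q))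
  bound : ∀ n → 2 ≤ n → n ^ suc p ≤ suc C * (D * D) * Sbar2 n ^ q
  bound n 2≤n with sqB-bracket n 2≤n
  ... | m , lower , upper = *-cancelʳ-≤ _ (suc C * (D * D) * Sbar2 n ^ q) (W ^ q) {{m^n≢0 W q}} (begin
    n ^ suc p * W ^ q                    ≤⟨ *-monoʳ-≤ (n ^ suc p) W^q≤k^2q ⟩
    n ^ suc p * (3 + m) ^ (q + q)        ≤⟨ pow-mul-poly-≤ p (q + q) {C} {D} m sqB-bound upper ⟩
    C * D ^ (3 + m)                      ≡⟨ regroup C D (D ^ suc m) ⟩
    C * (D * D) * D ^ suc m              ≡⟨ cong (C * (D * D) *_) (^-^-comm 4 q (suc m)) ⟩
    C * (D * D) * (4 ^ suc m) ^ q
      ≤⟨ *-mono-≤ (*-monoˡ-≤ (D * D) (n≤1+n C)) (^-monoˡ-≤ q (4^≤Sbar2 {n} m lower)) ⟩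
    suc C * (D * D) * (Sbar2 n * W) ^ q  ≡⟨ cong (suc C * (D * D) *_) (^-distrib-* (Sbar2 n) W q) ⟩
    suc C * (D * D) * (Sbar2 n ^ q * W ^ q) ≡⟨ *-assoc (suc C * (D * D)) _ _ ⟨
    suc C * (D * D) * Sbar2 n ^ q * W ^ q ∎)
    where
    open ≤-Reasoning
    W = (2 + m) * (3 + m)
    W^q≤k^2q : W ^ q ≤ (3 + m) ^ (q + q)
    W^q≤k^2q = ≤-trans (^-monoˡ-≤ q (*-monoˡ-≤ (3 + m) (n≤1+n (2 + m))))
                       (≤-reflexive (trans (^-distrib-* (3 + m) (3 + m) q) (sym (^-distribˡ-+-* (3 + m) q q))))
    regroup : ∀ c d x → c * (d * (d * x)) ≡ c * (d * d) * x
    regroup = solve-∀
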